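{- Let $k$ be a positive integer and let $e$ be an edge of a matching $M$. If $e$ is crossed by at least $2(k-1)^2+2$ edges of $M$, then $M$ contains either a broken nesting or an interleaving of length $k$ (i.e., with $k$ edges).
   Context: A matching is a graph on the vertex set $[2n]=\{1,\dots,2n\}$ in which every vertex is incident to exactly one edge. Two edges $a\sim b$ and $c\sim d$ with $a<b$, $c<d$ cross if $a<c<b<d$ or $c<a<d<b$. A matching $M$ contains a matching $N$ if $N$ can be obtained from $M$ by deleting a collection of edges together with their endpoints and relabeling the remaining vertices order-preservingly by $1,2,\dots$. The interleaving on $[2n]$ is the matching with edges $i\sim i+n$ for $i\in[n]$. The right-broken nesting on $[2n]$ has edges $n\sim 2n$ and $i\sim 2n-i$ for $i\in[n-1]$; the left-broken nesting on $[2n]$ has edges $1\sim n+1$ and $i+1\sim 2n-i+1$ for $i\in[n-1]$; a broken nesting is a left- or right-broken nesting. -}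

module Defs where

open import Data.Nat using (ℕ; zero; suc; _+_; _*_; _∸_)
open import Data.Fin using (Fin; toℕ; _<_)
open import Data.Product using (Σ; ∃; _×_)
open import Data.Sum using (_⊎_)
open import Function.Definitions using (Injective)
open import Relation.Binary.PropositionalEquality using (_≡_)
open import Relation.Nullary using (¬_)

-- Vertices of [2n] are represented 0-indexed as Fin (2 * n):
-- vertex v ∈ Fin (2 * n) stands for the paper's vertex toℕ v + 1.
-- A matching on [2n] is given by its partner map: a fixed-point-free involution.
record Matching (n : ℕ) : Set where
  field
    partner     : Fin (2 * n) → Fin (2 * n)
    involutive  : ∀ v → partner (partner v) ≡ v
    no-fixpoint : ∀ v → ¬ (partner v ≡ v)
open Matching public

Cross : ∀ {m} → Fin m → Fin m → Fin m → Fin m → Set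
Cross a b c d = (a < c × c < b × b < d) ⊎ (c < a × a < d × d < b)

-- The edge with smaller endpoint a of M (i.e. a < partner a) is crossed by the
-- edge with smaller endpoint c.
CrossesEdge : ∀ {n} (M : Matching n) → Fin (2 * n) → Fin (2 * n) → Set
CrossesEdge M a c = c < partner M c × Cross a (partner M a) c (partner M c)

-- The image is
-- then a union of edges of M, and deleting all other edges of M and relabeling
-- order-preservingly gives N.
Contains : ∀ {n k} → Matching n → Matching k → Set
Contains {n} {k} M N =
  Σ (Fin (2 * k) → Fin (2 * n)) λ f →
    (∀ i j → i < j → f i < f j) ×
    (∀ i → partner M (f i) ≡ f (partner N i))

-- Interleaving on [2k]: edges i ∼ i + k (paper, 1-indexed); 0-indexed: i ∼ i + k, i < k.
IsInterleaving : ∀ {k} → Matching k → Set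
IsInterleaving {k} N =
  ∀ (i : Fin (2 * k)) → toℕ i Data.Nat.< k → toℕ (partner N i) ≡ toℕ i + k

-- Right-broken nesting on [2k]: edges k ∼ 2k and i ∼ 2k - i for i ∈ [k-1] (1-indexed).
-- 0-indexed: (k-1) ∼ (2k-1) and j ∼ 2k-2-j for j < k-1.
IsRightBrokenNesting : ∀ {k} → Matching k → Set
IsRightBrokenNesting {k} N =
  (∀ (i : Fin (2 * k)) → toℕ i ≡ k ∸ 1 → toℕ (partner N i) ≡ 2 * k ∸ 1) ×
  (∀ (i : Fin (2 * k)) → toℕ i Data.Nat.< k ∸ 1 → toℕ (partner N i) ≡ 2 * k ∸ 2 ∸ toℕ i)

-- Left-broken nesting on [2k]: edges 1 ∼ k+1 and i+1 ∼ 2k-i+1 for i ∈ [k-1] (1-indexed).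
-- 0-indexed: 0 ∼ k and j ∼ 2k - j for 1 ≤ j ≤ k-1.
IsLeftBrokenNesting : ∀ {k} → Matching k → Set
IsLeftBrokenNesting {k} N =
  (∀ (i : Fin (2 * k)) → toℕ i ≡ 0 → toℕ (partner N i) ≡ k) ×
  (∀ (i : Fin (2 * k)) → 1 Data.Nat.≤ toℕ i → toℕ i Data.Nat.< k →
     toℕ (partner N i) ≡ 2 * k ∸ toℕ i)

IsBrokenNesting : ∀ {k} → Matching k → Set
IsBrokenNesting N = IsLeftBrokenNesting N ⊎ IsRightBrokenNesting N

module Submission where

-- Write k = m + 1 and name each crossing edge by its left endpoint x: it
-- crosses from the right (a < x < b < partner x) or from the left
-- (x < a < partner x < b), so one side has more than m(m-1) crossers.  Listed
-- by position and labelled by their partners they satisfy Erdős–Szekeres: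
-- either m + 1 of them have increasing partners, so all their left endpoints
-- precede all their right endpoints and they form an interleaving, or m of
-- them have decreasing partners and, together with a ∼ b, form a left-broken
-- (right crossers) or right-broken (left crossers) nesting.

open import Defs
open import Data.Nat as ℕ using (ℕ; zero; suc; _+_; _*_; _∸_; _^_; _≥_; pred; z≤n; s≤s)
import Data.Nat.Properties as ℕ
open import Data.Fin using (Fin; zero; suc; toℕ; _≤_; _<_; _<?_; _↑ˡ_; _↑ʳ_; opposite)
open import Data.Fin.Properties
  using (toℕ-↑ˡ; toℕ-↑ʳ; toℕ<n; toℕ-fromℕ; opposite-prop; opposite-involutive; injective⇒≤)
import Data.Fin.Properties as Fin
open import Data.List as List using (List; length; filter; allFin; lookup)
open import Data.List.Membership.Propositional using (_∈_; find; lose)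
open import Data.List.Membership.Propositional.Properties using (∈-filter⁻; ∈-filter⁺; ∈-allFin)
open import Data.List.Relation.Unary.All as All using (All)
open import Data.List.Relation.Unary.All.Properties using (all-filter)
open import Data.List.Relation.Unary.Any as Any using (Any; here; there; any?)
open import Data.List.Relation.Unary.Any.Properties using (lookup-index)
open import Data.List.Relation.Unary.AllPairs as AllPairs using (AllPairs)
import Data.List.Relation.Unary.AllPairs.Properties as AllPairs
open import Data.Vec.Functional using (Vector; _++_; reverse) renaming (_∷_ to _∷ᵥ_; [] to []ᵥ)
open import Data.Vec.Functional.Properties using (lookup-++ˡ; lookup-++ʳ)
open import Data.Product using (Σ; _×_; _,_; proj₁; proj₂; map₁; map₂)
open import Data.Sum using (_⊎_; inj₁; inj₂)
open import Data.Empty using (⊥-elim)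
open import Function using (_∘_; id; flip)
open import Function.Definitions using (Injective)
open import Relation.Nullary using (¬_; Dec; yes; no; _×-dec_; _⊎-dec_; ¬?; contradiction)
open import Relation.Nullary.Decidable using (toSum)
open import Relation.Unary using (Decidable)
open import Relation.Binary using (tri<; tri≈; tri>)
open import Relation.Binary.PropositionalEquality
  using (_≡_; refl; sym; trans; cong; subst; subst₂; module ≡-Reasoning)

private variable
  A : Set
  k m n : ℕ

Pairwise : (A → A → Set) → Vector A k → Set
Pairwise R c = ∀ {i j} → i < j → R (c i) (c j)

∷-pairwise : ∀ {R : A → A → Set} {x} {c : Vector A k} →
  (∀ j → R x (c j)) → Pairwise R c → Pairwise R (x ∷ᵥ c)
∷-pairwise x-c c-R {zero}  {zero}  ()
∷-pairwise x-c c-R {zero}  {suc j} _ = x-c j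
∷-pairwise x-c c-R {suc i} {zero}  ()
∷-pairwise x-c c-R {suc i} {suc j} (s≤s i<j) = c-R i<j

opposite-< : ∀ {i j : Fin n} → i < j → opposite j < opposite i
opposite-< {n} {i} {j} i<j =
  subst₂ ℕ._<_ (sym (opposite-prop j)) (sym (opposite-prop i))
    (ℕ.∸-monoʳ-< (s≤s i<j) (toℕ<n j))

reverse-pairwise : ∀ {R : A → A → Set} {c : Vector A k} →
  Pairwise R c → Pairwise (flip R) (reverse c)
reverse-pairwise c-R i<j = c-R (opposite-< i<j)

data Block (m n : ℕ) : Fin (m + n) → Set where
  left  : (s : Fin m) → Block m n (s ↑ˡ n)
  right : (t : Fin n) → Block m n (m ↑ʳ t)

block : ∀ m {n} (i : Fin (m + n)) → Block m n i
block zero    i       = right i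
block (suc m) zero    = left zero
block (suc m) (suc i) with block m i
... | left s  = left (suc s)
... | right t = right t

++-pairwise : ∀ {R : A → A → Set} {xs : Vector A m} {ys : Vector A n} →
  Pairwise R xs → Pairwise R ys → (∀ s t → R (xs s) (ys t)) →
  Pairwise R (xs ++ ys)
++-pairwise {m = m} {n} {R = R} {xs} {ys} xs-R ys-R xs-ys {i} {j} =
  go (block m i) (block m j)
  where
  go : ∀ {i j} → Block m n i → Block m n j → i < j → R ((xs ++ ys) i) ((xs ++ ys) j)
  go (left s) (left s′) lt =
    subst₂ R (sym (lookup-++ˡ xs ys s)) (sym (lookup-++ˡ xs ys s′))
      (xs-R (subst₂ ℕ._<_ (toℕ-↑ˡ s n) (toℕ-↑ˡ s′ n) lt))
  go (left s) (right t) _ =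
    subst₂ R (sym (lookup-++ˡ xs ys s)) (sym (lookup-++ʳ xs ys t)) (xs-ys s t)
  go (right t) (left s) lt = ⊥-elim (ℕ.m+n≮m m (toℕ t)
    (ℕ.<-trans (subst₂ ℕ._<_ (toℕ-↑ʳ m t) (toℕ-↑ˡ s n) lt) (toℕ<n s)))
  go (right t) (right t′) lt =
    subst₂ R (sym (lookup-++ʳ xs ys t)) (sym (lookup-++ʳ xs ys t′))
      (ys-R (ℕ.+-cancelˡ-< m _ _ (subst₂ ℕ._<_ (toℕ-↑ʳ m t) (toℕ-↑ʳ m t′) lt)))

injection-length : ∀ {L} {xs : List A} (g : Fin L → A) → Injective _≡_ _≡_ g →
  (∀ j → g j ∈ xs) → L ℕ.≤ length xs
injection-length {xs = xs} g g-inj g∈ = injective⇒≤ index-injective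
  where
  index-injective : Injective _≡_ _≡_ (λ j → Any.index (g∈ j))
  index-injective {i} {j} eq = g-inj (trans (lookup-index (g∈ i))
    (trans (cong (lookup xs) eq) (sym (lookup-index (g∈ j)))))

length-filter-cover : ∀ {P Q : A → Set} (P? : Decidable P) (Q? : Decidable Q) xs →
  All (λ x → P x ⊎ Q x) xs → length xs ℕ.≤ length (filter P? xs) + length (filter Q? xs)
length-filter-cover P? Q? List.[] All.[] = z≤n
length-filter-cover P? Q? (x List.∷ xs) (px⊎qx All.∷ cover)
  with ih ← length-filter-cover P? Q? xs cover | P? x | Q? x
... | yes _ | yes _ = s≤s (ℕ.≤-trans ih (ℕ.+-monoʳ-≤ _ (ℕ.n≤1+n _)))
... | yes _ | no _  = s≤s ih
... | no _  | yes _ = ℕ.≤-trans (s≤s ih) (ℕ.≤-reflexive (sym (ℕ.+-suc _ _)))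
... | no ¬p | no ¬q with px⊎qx
...   | inj₁ p = contradiction p ¬p
...   | inj₂ q = contradiction q ¬q

allFin-sorted : ∀ N → AllPairs _<_ (allFin N)
allFin-sorted N = AllPairs.tabulate⁺-< (λ i<j → i<j)

Chain : (A → A → Set) → ℕ → List A → Set
Chain {A} R ℓ xs = Σ (Vector A ℓ) λ c → Pairwise R c × (∀ i → c i ∈ xs)

chain-⊆ : ∀ {R : A → A → Set} {ℓ xs ys} →
  (∀ {x} → x ∈ ys → x ∈ xs) → Chain R ℓ ys → Chain R ℓ xs
chain-⊆ ys⊆xs (c , c-R , c∈) = c , c-R , ys⊆xs ∘ c∈

prefix-chain : ∀ {R : A → A → Set} {ys} s → AllPairs R ys → s ℕ.≤ length ys → Chain R s ys
prefix-chain zero _ _ = []ᵥ , (λ { {()} }) , λ ()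
prefix-chain {R = R} {ys = y List.∷ ys} (suc s) (y-ys AllPairs.∷ ys-R) (s≤s s≤len)
  with c , c-R , c∈ ← prefix-chain s ys-R s≤len =
  y ∷ᵥ c , ∷-pairwise {R = R} (λ j → All.lookup y-ys (c∈ j)) c-R ,
  λ { zero → here refl ; (suc i) → there (c∈ i) }

allPairs-refine : ∀ {R S : A → A → Set} {Q : A → Set} →
  (∀ {u v} → Q u → Q v → R u v → S u v) →
  ∀ {xs} → All Q xs → AllPairs R xs → AllPairs S xs
allPairs-refine f All.[] AllPairs.[] = AllPairs.[]
allPairs-refine f (qx All.∷ qxs) (rx AllPairs.∷ rxs) =
  All.zipWith (λ (qy , rxy) → f qx qy rxy) (qxs , rx) AllPairs.∷ allPairs-refine f qxs rxs

module ErdősSzekeres {N : ℕ} (D : Fin N → ℕ) (D-injective : Injective _≡_ _≡_ D) where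

  Ascent Descent : Fin N → Fin N → Set
  Ascent  u v = u < v × D u ℕ.< D v
  Descent u v = u < v × D v ℕ.< D u

  ascent-trans : ∀ {u v w} → Ascent u v → Ascent v w → Ascent u w
  ascent-trans (u<v , Du<Dv) (v<w , Dv<Dw) = ℕ.<-trans u<v v<w , ℕ.<-trans Du<Dv Dv<Dw

  -- v is the end of an ascent starting in xs; otherwise v is a record of xs.
  Ascended : List (Fin N) → Fin N → Set
  Ascended xs v = Any (λ u → Ascent u v) xs

  ascended? : ∀ xs v → Dec (Ascended xs v)
  ascended? xs v = any? (λ u → (u <? v) ×-dec (D u ℕ.<? D v)) xs

  record-descent : ∀ {xs u v} → u ∈ xs → ¬ Ascended xs v → u < v → Descent u v
  record-descent {u = u} {v} u∈xs v-record u<v with ℕ.<-cmp (D u) (D v)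
  ... | tri< Du<Dv _ _ = contradiction (lose u∈xs (u<v , Du<Dv)) v-record
  ... | tri≈ _ Du≡Dv _ = contradiction (D-injective Du≡Dv) (Fin.<⇒≢ u<v)
  ... | tri> _ _ Dv<Du = u<v , Dv<Du

  records ascendeds : List (Fin N) → List (Fin N)
  records   xs = filter (¬? ∘ ascended? xs) xs
  ascendeds xs = filter (ascended? xs) xs

  records+ascendeds : ∀ xs → length xs ℕ.≤ length (ascendeds xs) + length (records xs)
  records+ascendeds xs = length-filter-cover (ascended? xs) (¬? ∘ ascended? xs) xs
    (All.universal (toSum ∘ ascended? xs) xs)

  records-⊆ : ∀ {x xs} → x ∈ records xs → x ∈ xs
  records-⊆ {xs = xs} = proj₁ ∘ ∈-filter⁻ (¬? ∘ ascended? xs)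

  ascendeds-⊆ : ∀ {x xs} → x ∈ ascendeds xs → x ∈ xs
  ascendeds-⊆ {xs = xs} = proj₁ ∘ ∈-filter⁻ (ascended? xs)

  records-descend : ∀ {xs} → AllPairs _<_ xs → AllPairs Descent (records xs)
  records-descend {xs} sorted = allPairs-refine
    (λ (u∈xs , _) (_ , v-record) → record-descent {xs} u∈xs v-record)
    (All.tabulate (∈-filter⁻ (¬? ∘ ascended? xs)))
    (AllPairs.filter⁺ (¬? ∘ ascended? xs) sorted)

  extend-ascent : ∀ {ℓ xs ys} → (∀ {x} → x ∈ ys → x ∈ xs) →
    ((c , _ , _) : Chain Ascent (suc ℓ) ys) → Ascended xs (c zero) →
    Chain Ascent (suc (suc ℓ)) xs
  extend-ascent ys⊆xs (c , c-asc , c∈) ascended with x , x∈xs , x-c₀ ← find ascended =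
    x ∷ᵥ c , ∷-pairwise {R = Ascent} x-c c-asc , λ { zero → x∈xs ; (suc i) → ys⊆xs (c∈ i) }
    where
    x-c : ∀ j → Ascent x (c j)
    x-c zero    = x-c₀
    x-c (suc j) = ascent-trans x-c₀ (c-asc {zero} {suc j} (s≤s z≤n))

  -- Induction on r: the records
  -- of xs descend; if there are fewer than s of them, the ascended elements are
  -- more than r·(s-1) and their ascending (r+1)-chain extends to the left.
  erdős–szekeres : ∀ r s xs → AllPairs _<_ xs → r * pred s ℕ.< length xs →
    Chain Ascent (suc r) xs ⊎ Chain Descent s xs
  erdős–szekeres zero s (x List.∷ xs) _ _ =
    inj₁ ((λ _ → x) , (λ { {zero} {zero} () }) , λ _ → here refl)
  erdős–szekeres (suc r) s xs sorted long with s ℕ.≤? length (records xs)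
  ... | yes many = inj₂ (chain-⊆ {R = Descent} records-⊆
                           (prefix-chain s (records-descend sorted) many))
  ... | no few with erdős–szekeres r s (ascendeds xs)
                      (AllPairs.filter⁺ (ascended? xs) sorted) many-ascended
    where
    many-ascended : r * pred s ℕ.< length (ascendeds xs)
    many-ascended = ℕ.+-cancelˡ-< (pred s) _ _ (begin-strict
      pred s + r * pred s                            <⟨ long ⟩
      length xs                                      ≤⟨ records+ascendeds xs ⟩
      length (ascendeds xs) + length (records xs)    ≤⟨ ℕ.+-monoʳ-≤ _ (ℕ.<⇒≤pred (ℕ.≰⇒> few)) ⟩
      length (ascendeds xs) + pred s                 ≡⟨ ℕ.+-comm _ (pred s) ⟩
      pred s + length (ascendeds xs)                 ∎)
      where open ℕ.≤-Reasoning
  ...   | inj₁ asc@(c , _ , c∈) = inj₁ (extend-ascent ascendeds-⊆ asc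
                                    (proj₂ (∈-filter⁻ (ascended? xs) {xs = xs} (c∈ zero))))
  ...   | inj₂ desc = inj₂ (chain-⊆ {R = Descent} ascendeds-⊆ desc)

partner-injective : ∀ {n} (M : Matching n) → Injective _≡_ _≡_ (partner M)
partner-injective M {u} {v} eq =
  trans (sym (involutive M u)) (trans (cong (partner M) eq) (involutive M v))

increasing-injective : ∀ {N k} {V : Vector (Fin N) k} → Pairwise _<_ V → Injective _≡_ _≡_ V
increasing-injective V-inc {i} {j} eq with Fin.<-cmp i j
... | tri< i<j _ _ = contradiction eq (Fin.<⇒≢ (V-inc i<j))
... | tri≈ _ i≡j _ = i≡j
... | tri> _ _ j<i = contradiction (sym eq) (Fin.<⇒≢ (V-inc j<i))

induced : ∀ {n k} (M : Matching n) (V : Vector (Fin (2 * n)) (2 * k)) → Pairwise _<_ V →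
  (∀ i → Σ (Fin (2 * k)) λ j → partner M (V i) ≡ V j) →
  Σ (Matching k) λ N → Contains M N × (∀ i j → partner M (V i) ≡ V j → partner N i ≡ j)
induced {k = k} M V V-inc closed = N , (V , (λ _ _ → V-inc) , proj₂ ∘ closed) , partner-N
  where
  V-injective : Injective _≡_ _≡_ V
  V-injective = increasing-injective V-inc
  N : Matching k
  N = record
    { partner     = proj₁ ∘ closed
    ; involutive  = λ i → V-injective (begin
        V (proj₁ (closed (proj₁ (closed i)))) ≡⟨ sym (proj₂ (closed (proj₁ (closed i)))) ⟩
        partner M (V (proj₁ (closed i)))      ≡⟨ cong (partner M) (sym (proj₂ (closed i))) ⟩
        partner M (partner M (V i))           ≡⟨ involutive M (V i) ⟩
        V i                                   ∎)
    ; no-fixpoint = λ i fixed → no-fixpoint M (V i) (trans (proj₂ (closed i)) (cong V fixed))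
    }
    where open ≡-Reasoning
  partner-N : ∀ i j → partner M (V i) ≡ V j → proj₁ (closed i) ≡ j
  partner-N i j pair = V-injective (trans (sym (proj₂ (closed i))) pair)

-- Every index in the left half of Fin (2 * k) is s ↑ˡ k for some s : Fin k
-- (note that 2 * k unfolds to k + (k + 0)).
left-half : ∀ {k} {P : Fin (2 * k) → Set} →
  (∀ s → P (s ↑ˡ (k + 0))) → ∀ i → toℕ i ℕ.< k → P i
left-half {k} {P} P-left i = go (block k i)
  where
  go : ∀ {i} → Block k (k + 0) i → toℕ i ℕ.< k → P i
  go (left s)  _  = P-left s
  go (right t) lt = ⊥-elim (ℕ.m+n≮m k (toℕ t) (subst (ℕ._< k) (toℕ-↑ʳ k t) lt))

LeftPartners : ∀ {k} → Matching k → (Fin k → Fin k) → Set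
LeftPartners {k} N σ = ∀ s → toℕ (partner N (s ↑ˡ (k + 0))) ≡ k + toℕ (σ s)

two-blocks : ∀ {n k} (M : Matching n) (L R : Vector (Fin (2 * n)) k) (σ : Fin k → Fin k) →
  Pairwise _<_ L → Pairwise _<_ R → (∀ s t → L s < R t) →
  (∀ s → σ (σ s) ≡ s) → (∀ s → partner M (L s) ≡ R (σ s)) →
  Σ (Matching k) λ N → Contains M N × LeftPartners N σ
two-blocks {n} {k} M L R σ L-inc R-inc L<R σ-involutive L-partner =
  N , N⊆M , λ s → begin
    toℕ (partner N (s ↑ˡ (k + 0)))  ≡⟨ cong toℕ (partner-N _ _ (left-pair s)) ⟩
    toℕ (k ↑ʳ (σ s ↑ˡ 0))           ≡⟨ toℕ-↑ʳ k (σ s ↑ˡ 0) ⟩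
    k + toℕ (σ s ↑ˡ 0)              ≡⟨ cong (k +_) (toℕ-↑ˡ (σ s) 0) ⟩
    k + toℕ (σ s)                   ∎
  where
  open ≡-Reasoning
  -- R padded to length k + 0, so that L ++ R′ has length 2 * k.
  R′ : Vector (Fin (2 * n)) (k + 0)
  R′ = R ++ []ᵥ
  R′-entries : ∀ {P : Fin (2 * n) → Set} → (∀ u → P (R u)) → ∀ t → P (R′ t)
  R′-entries {P} P-R t with block k t
  ... | left u = subst P (sym (lookup-++ˡ R []ᵥ u)) (P-R u)
  V : Vector (Fin (2 * n)) (2 * k)
  V = L ++ R′
  V-inc : Pairwise _<_ V
  V-inc = ++-pairwise {R = _<_} {xs = L} {ys = R′} L-inc
            (++-pairwise {R = _<_} {xs = R} {ys = []ᵥ} R-inc (λ { {()} }) (λ _ ()))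
            (λ s → R′-entries {P = L s <_} (L<R s))
  left-pair : ∀ s → partner M (V (s ↑ˡ (k + 0))) ≡ V (k ↑ʳ (σ s ↑ˡ 0))
  left-pair s = begin
    partner M (V (s ↑ˡ (k + 0))) ≡⟨ cong (partner M) (lookup-++ˡ L R′ s) ⟩
    partner M (L s)              ≡⟨ L-partner s ⟩
    R (σ s)                      ≡⟨ lookup-++ˡ R []ᵥ (σ s) ⟨
    R′ (σ s ↑ˡ 0)                ≡⟨ lookup-++ʳ L R′ (σ s ↑ˡ 0) ⟨
    V (k ↑ʳ (σ s ↑ˡ 0))          ∎
  right-pair : ∀ u → partner M (V (k ↑ʳ (u ↑ˡ 0))) ≡ V (σ u ↑ˡ (k + 0))
  right-pair u = begin
    partner M (V (k ↑ʳ (u ↑ˡ 0)))       ≡⟨ cong (partner M) (lookup-++ʳ L R′ (u ↑ˡ 0)) ⟩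
    partner M (R′ (u ↑ˡ 0))             ≡⟨ cong (partner M) (lookup-++ˡ R []ᵥ u) ⟩
    partner M (R u)                     ≡⟨ cong (partner M ∘ R) (σ-involutive u) ⟨
    partner M (R (σ (σ u)))             ≡⟨ cong (partner M) (L-partner (σ u)) ⟨
    partner M (partner M (L (σ u)))     ≡⟨ involutive M (L (σ u)) ⟩
    L (σ u)                             ≡⟨ lookup-++ˡ L R′ (σ u) ⟨
    V (σ u ↑ˡ (k + 0))                  ∎
  closed : ∀ i → Σ (Fin (2 * k)) λ j → partner M (V i) ≡ V j
  closed i with block k i
  ... | left s = _ , left-pair s
  ... | right t with block k t
  ...   | left u = _ , right-pair u
  N : Matching k
  N = proj₁ (induced {k = k} M V V-inc closed)
  N⊆M : Contains M N
  N⊆M = proj₁ (proj₂ (induced {k = k} M V V-inc closed))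
  partner-N : ∀ i j → partner M (V i) ≡ V j → partner N i ≡ j
  partner-N = proj₂ (proj₂ (induced {k = k} M V V-inc closed))

suc[m∸1+x]≡m∸x : ∀ {m x} → x ℕ.< m → suc (m ∸ suc x) ≡ m ∸ x
suc[m∸1+x]≡m∸x x<m = sym (ℕ.+-∸-assoc 1 x<m)

k+[k∸x]≡2k∸x : ∀ k {x} → x ℕ.≤ k → k + (k ∸ x) ≡ 2 * k ∸ x
k+[k∸x]≡2k∸x k {x} x≤k = begin
  k + (k ∸ x)   ≡⟨ ℕ.+-∸-assoc k x≤k ⟨
  k + k ∸ x     ≡⟨ cong (λ y → k + y ∸ x) (ℕ.+-identityʳ k) ⟨
  2 * k ∸ x     ∎
  where open ≡-Reasoning

2*[1+m]∸2≡m+m : ∀ m → 2 * suc m ∸ 2 ≡ m + m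
2*[1+m]∸2≡m+m m = begin
  m + suc (m + 0) ∸ 1   ≡⟨ cong (_∸ 1) (ℕ.+-suc m (m + 0)) ⟩
  m + (m + 0)           ≡⟨ cong (m +_) (ℕ.+-identityʳ m) ⟩
  m + m                 ∎
  where open ≡-Reasoning

interleaving-from : ∀ {k} (N : Matching k) →
  LeftPartners N (λ s → s) → IsInterleaving N
interleaving-from {k} N partner-left =
  left-half {P = λ i → toℕ (partner N i) ≡ toℕ i + k} λ s → begin
    toℕ (partner N (s ↑ˡ (k + 0)))  ≡⟨ partner-left s ⟩
    k + toℕ s                       ≡⟨ ℕ.+-comm k (toℕ s) ⟩
    toℕ s + k                       ≡⟨ cong (_+ k) (toℕ-↑ˡ s (k + 0)) ⟨
    toℕ (s ↑ˡ (k + 0)) + k          ∎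
  where open ≡-Reasoning

reflect-tail : ∀ {m} → Fin (suc m) → Fin (suc m)
reflect-tail zero    = zero
reflect-tail (suc t) = suc (opposite t)

reflect-tail-involutive : ∀ {m} (s : Fin (suc m)) → reflect-tail (reflect-tail s) ≡ s
reflect-tail-involutive zero    = refl
reflect-tail-involutive (suc t) = cong suc (opposite-involutive t)

toℕ-reflect-tail : ∀ {m} (t : Fin m) → toℕ (reflect-tail (suc t)) ≡ m ∸ toℕ t
toℕ-reflect-tail t = trans (cong suc (opposite-prop t)) (suc[m∸1+x]≡m∸x (toℕ<n t))

-- In the left-broken nesting 0 is matched with k and 1 ≤ s < k with 2k - s,
-- i.e. s is matched with k + reflect-tail s.
left-broken-from : ∀ {m} (N : Matching (suc m)) →
  LeftPartners N reflect-tail →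
  IsLeftBrokenNesting N
left-broken-from {m} N partner-left = first , λ i 1≤i i<k → left-half {P = Tail} tail i i<k 1≤i
  where
  open ≡-Reasoning
  first : ∀ i → toℕ i ≡ 0 → toℕ (partner N i) ≡ suc m
  first zero _ = trans (partner-left zero) (ℕ.+-identityʳ (suc m))
  Tail : Fin (2 * suc m) → Set
  Tail i = 1 ℕ.≤ toℕ i → toℕ (partner N i) ≡ 2 * suc m ∸ toℕ i
  tail : ∀ s → Tail (s ↑ˡ (suc m + 0))
  tail zero    ()
  tail (suc t) _ = begin
    toℕ (partner N (suc t ↑ˡ (suc m + 0)))  ≡⟨ partner-left (suc t) ⟩
    suc m + toℕ (reflect-tail (suc t))      ≡⟨ cong (suc m +_) (toℕ-reflect-tail t) ⟩
    suc m + (suc m ∸ toℕ (suc t))           ≡⟨ k+[k∸x]≡2k∸x (suc m) (ℕ.<⇒≤ (toℕ<n (suc t))) ⟩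
    2 * suc m ∸ toℕ (suc t)                 ≡⟨ cong (2 * suc m ∸_) (toℕ-↑ˡ (suc t) (suc m + 0)) ⟨
    2 * suc m ∸ toℕ (suc t ↑ˡ (suc m + 0))  ∎

reflect-init : ∀ {m} → Fin (suc m) → Fin (suc m)
reflect-init = opposite ∘ reflect-tail ∘ opposite

reflect-init-involutive : ∀ {m} (s : Fin (suc m)) → reflect-init (reflect-init s) ≡ s
reflect-init-involutive s = begin
  opposite (reflect-tail (opposite (opposite (reflect-tail (opposite s)))))
    ≡⟨ cong (opposite ∘ reflect-tail) (opposite-involutive (reflect-tail (opposite s))) ⟩
  opposite (reflect-tail (reflect-tail (opposite s)))
    ≡⟨ cong opposite (reflect-tail-involutive (opposite s)) ⟩
  opposite (opposite s)
    ≡⟨ opposite-involutive s ⟩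
  s ∎
  where open ≡-Reasoning

toℕ-reflect-init-last : ∀ {m} (s : Fin (suc m)) → toℕ s ≡ m → toℕ (reflect-init s) ≡ m
toℕ-reflect-init-last {m} s s≡m = last (opposite s) (opposite-prop s)
  where
  last : ∀ u → toℕ u ≡ m ∸ toℕ s → toℕ (opposite (reflect-tail u)) ≡ m
  last zero    _  = toℕ-fromℕ m
  last (suc t) eq = contradiction (trans eq (trans (cong (m ∸_) s≡m) (ℕ.n∸n≡0 m))) λ ()

toℕ-reflect-init : ∀ {m} (s : Fin (suc m)) → toℕ s ℕ.< m → toℕ (reflect-init s) ≡ m ∸ suc (toℕ s)
toℕ-reflect-init {m} s s<m = init (opposite s) (opposite-prop s)
  where
  open ≡-Reasoning
  init : ∀ u → toℕ u ≡ m ∸ toℕ s → toℕ (opposite (reflect-tail u)) ≡ m ∸ suc (toℕ s)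
  init zero    eq = contradiction eq (ℕ.<⇒≢ (ℕ.m<n⇒0<n∸m s<m))
  init (suc t) eq = begin
    toℕ (opposite (reflect-tail (suc t))) ≡⟨ opposite-prop (reflect-tail (suc t)) ⟩
    m ∸ toℕ (reflect-tail (suc t))        ≡⟨ cong (m ∸_) (toℕ-reflect-tail t) ⟩
    m ∸ (m ∸ toℕ t)                       ≡⟨ ℕ.m∸[m∸n]≡n (ℕ.<⇒≤ (toℕ<n t)) ⟩
    toℕ t                                 ≡⟨ cong pred eq ⟩
    pred (m ∸ toℕ s)                      ≡⟨ ℕ.pred[m∸n]≡m∸[1+n] m (toℕ s) ⟩
    m ∸ suc (toℕ s)                       ∎

-- In the right-broken nesting k-1 is matched with 2k-1 and s < k-1 with
-- 2k-2-s, i.e. s is matched with k + reflect-init s.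
right-broken-from : ∀ {m} (N : Matching (suc m)) →
  LeftPartners N reflect-init →
  IsRightBrokenNesting N
right-broken-from {m} N partner-left =
  (λ i i≡m → left-half {P = Last} last i (s≤s (ℕ.≤-reflexive i≡m)) i≡m) ,
  (λ i i<m → left-half {P = Init} init i (ℕ.m<n⇒m<1+n i<m) i<m)
  where
  open ≡-Reasoning
  Last Init : Fin (2 * suc m) → Set
  Last i = toℕ i ≡ m → toℕ (partner N i) ≡ 2 * suc m ∸ 1
  Init i = toℕ i ℕ.< m → toℕ (partner N i) ≡ 2 * suc m ∸ 2 ∸ toℕ i
  last : ∀ s → Last (s ↑ˡ (suc m + 0))
  last s s≡m = begin
    toℕ (partner N (s ↑ˡ (suc m + 0)))  ≡⟨ partner-left s ⟩
    suc m + toℕ (reflect-init s)        ≡⟨ cong (suc m +_) (toℕ-reflect-init-last s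
                                             (trans (sym (toℕ-↑ˡ s (suc m + 0))) s≡m)) ⟩
    suc m + m                           ≡⟨ ℕ.+-comm (suc m) m ⟩
    m + suc m                           ≡⟨ cong (m +_) (ℕ.+-identityʳ (suc m)) ⟨
    2 * suc m ∸ 1                       ∎
  init : ∀ s → Init (s ↑ˡ (suc m + 0))
  init s s<m′ = begin
    toℕ (partner N (s ↑ˡ (suc m + 0)))  ≡⟨ partner-left s ⟩
    suc m + toℕ (reflect-init s)        ≡⟨ cong (suc m +_) (toℕ-reflect-init s s<m) ⟩
    suc (m + (m ∸ suc (toℕ s)))         ≡⟨ ℕ.+-suc m (m ∸ suc (toℕ s)) ⟨
    m + suc (m ∸ suc (toℕ s))           ≡⟨ cong (m +_) (suc[m∸1+x]≡m∸x s<m) ⟩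
    m + (m ∸ toℕ s)                     ≡⟨ ℕ.+-∸-assoc m (ℕ.<⇒≤ s<m) ⟨
    m + m ∸ toℕ s                       ≡⟨ cong (_∸ toℕ s) (2*[1+m]∸2≡m+m m) ⟨
    2 * suc m ∸ 2 ∸ toℕ s               ≡⟨ cong (2 * suc m ∸ 2 ∸_) (toℕ-↑ˡ s (suc m + 0)) ⟨
    2 * suc m ∸ 2 ∸ toℕ (s ↑ˡ (suc m + 0)) ∎
    where
    s<m : toℕ s ℕ.< m
    s<m = ℕ.≤-trans (ℕ.≤-reflexive (cong suc (sym (toℕ-↑ˡ s (suc m + 0))))) s<m′

larger-side : ∀ m {a b} → 2 * m ^ 2 + 2 ℕ.≤ a + b → m * pred m ℕ.< a ⊎ m * pred m ℕ.< b
larger-side m {a} {b} total with m * pred m ℕ.<? a | m * pred m ℕ.<? b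
... | yes many-a | _ = inj₁ many-a
... | no _ | yes many-b = inj₂ many-b
... | no few-a | no few-b = ⊥-elim (ℕ.<-irrefl refl (begin-strict
  a + b                   ≤⟨ ℕ.+-mono-≤ (bound few-a) (bound few-b) ⟩
  m ^ 2 + m ^ 2           ≡⟨ cong (m ^ 2 +_) (ℕ.+-identityʳ (m ^ 2)) ⟨
  2 * m ^ 2               <⟨ ℕ.m<m+n (2 * m ^ 2) (s≤s z≤n) ⟩
  2 * m ^ 2 + 2           ≤⟨ total ⟩
  a + b                   ∎))
  where
  open ℕ.≤-Reasoning
  bound : ∀ {x} → ¬ (m * pred m ℕ.< x) → x ℕ.≤ m ^ 2
  bound few = ℕ.≤-trans (ℕ.≮⇒≥ few)
    (ℕ.≤-trans (ℕ.*-monoʳ-≤ m ℕ.pred[n]≤n) (ℕ.≤-reflexive (cong (m *_) (sym (ℕ.*-identityʳ m)))))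

module Crossings {n} (M : Matching n) (a : Fin (2 * n)) (a<Pa : a < partner M a) where

  P : Fin (2 * n) → Fin (2 * n)
  P = partner M

  RightCrosser LeftCrosser : Fin (2 * n) → Set
  RightCrosser x = a < x × x < P a × P a < P x
  LeftCrosser  x = x < a × a < P x × P x < P a

  rightCrosser? : Decidable RightCrosser
  rightCrosser? x = (a <? x) ×-dec (x <? P a) ×-dec (P a <? P x)

  leftCrosser? : Decidable LeftCrosser
  leftCrosser? x = (x <? a) ×-dec (a <? P x) ×-dec (P x <? P a)

  crossers rights lefts : List (Fin (2 * n))
  crossers = filter (λ x → rightCrosser? x ⊎-dec leftCrosser? x) (allFin (2 * n))
  rights   = filter rightCrosser? crossers
  lefts    = filter leftCrosser? crossers

  crossers-sorted : AllPairs _<_ crossers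
  crossers-sorted = AllPairs.filter⁺ _ (allFin-sorted (2 * n))

  crossers-count : ∀ {L} (g : Fin L → Fin (2 * n)) → Injective _≡_ _≡_ g →
    (∀ j → CrossesEdge M a (g j)) → L ℕ.≤ length rights + length lefts
  crossers-count g g-injective g-crosses = ℕ.≤-trans
    (injection-length g g-injective
      (λ j → ∈-filter⁺ (λ x → rightCrosser? x ⊎-dec leftCrosser? x) (∈-allFin (g j)) (proj₂ (g-crosses j))))
    (length-filter-cover rightCrosser? leftCrosser? crossers (all-filter _ (allFin (2 * n))))

  open ErdősSzekeres (toℕ ∘ P) (partner-injective M ∘ Fin.toℕ-injective)

  recognise : ∀ {k σ} {Pattern : Matching k → Set} → (∀ N → LeftPartners N σ → Pattern N) →
    (Σ (Matching k) λ N → Contains M N × LeftPartners N σ) →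
    Σ (Matching k) λ N → Pattern N × Contains M N
  recognise has-pattern (N , N⊆M , partner-left) = N , has-pattern N partner-left , N⊆M

  interleaving-in : ∀ {k} (c : Vector (Fin (2 * n)) k) → Pairwise Ascent c →
    (∀ i j → c i < P (c j)) → Σ (Matching k) λ N → IsInterleaving N × Contains M N
  interleaving-in c c-asc c<Pc = recognise interleaving-from
    (two-blocks M c (P ∘ c) id (proj₁ ∘ c-asc) (proj₂ ∘ c-asc) c<Pc (λ _ → refl) (λ _ → refl))

  -- A descending chain c of right crossers, together with a ∼ P a, spans a
  -- left-broken nesting: a < c₀ < … < c_{m-1} < P a < P c_{m-1} < … < P c₀.
  left-broken-in : ∀ {m} (c : Vector (Fin (2 * n)) m) → Pairwise Descent c →
    (∀ i → RightCrosser (c i)) → Σ (Matching (suc m)) λ N → IsLeftBrokenNesting N × Contains M N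
  left-broken-in {m} c c-desc c-right = recognise left-broken-from
    (two-blocks M L R reflect-tail L-inc R-inc L<R reflect-tail-involutive L-partner)
    where
    L R : Vector (Fin (2 * n)) (suc m)
    L = a ∷ᵥ c
    R = P a ∷ᵥ reverse (P ∘ c)
    L-inc : Pairwise _<_ L
    L-inc = ∷-pairwise {R = _<_} (λ j → proj₁ (c-right j)) (proj₁ ∘ c-desc)
    R-inc : Pairwise _<_ R
    R-inc = ∷-pairwise {R = _<_} (λ j → proj₂ (proj₂ (c-right (opposite j))))
              (reverse-pairwise {R = flip _<_} (proj₂ ∘ c-desc))
    L<Pa : ∀ s → L s < P a
    L<Pa zero    = a<Pa
    L<Pa (suc i) = proj₁ (proj₂ (c-right i))
    Pa≤R : ∀ t → P a ≤ R t
    Pa≤R zero    = ℕ.≤-refl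
    Pa≤R (suc j) = ℕ.<⇒≤ (proj₂ (proj₂ (c-right (opposite j))))
    L<R : ∀ s t → L s < R t
    L<R s t = ℕ.<-≤-trans (L<Pa s) (Pa≤R t)
    L-partner : ∀ s → P (L s) ≡ R (reflect-tail s)
    L-partner zero    = refl
    L-partner (suc t) = cong (P ∘ c) (sym (opposite-involutive t))

  -- A descending chain c of left crossers, together with a ∼ P a, spans a
  -- right-broken nesting: c₀ < … < c_{m-1} < a < P c_{m-1} < … < P c₀ < P a.
  right-broken-in : ∀ {m} (c : Vector (Fin (2 * n)) m) → Pairwise Descent c →
    (∀ i → LeftCrosser (c i)) → Σ (Matching (suc m)) λ N → IsRightBrokenNesting N × Contains M N
  right-broken-in {m} c c-desc c-left = recognise right-broken-from
    (two-blocks M (reverse L) (reverse R) reflect-init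
       (reverse-pairwise {R = flip _<_} L-dec) (reverse-pairwise {R = flip _<_} R-dec) L<R
       reflect-init-involutive L-partner)
    where
    -- L and R list the two blocks from the outside in.
    L R : Vector (Fin (2 * n)) (suc m)
    L = a ∷ᵥ reverse c
    R = P a ∷ᵥ (P ∘ c)
    L-dec : Pairwise (flip _<_) L
    L-dec = ∷-pairwise {R = flip _<_} (λ j → proj₁ (c-left (opposite j)))
              (reverse-pairwise {R = _<_} (proj₁ ∘ c-desc))
    R-dec : Pairwise (flip _<_) R
    R-dec = ∷-pairwise {R = flip _<_} (λ j → proj₂ (proj₂ (c-left j))) (proj₂ ∘ c-desc)
    L≤a : ∀ s → L s ≤ a
    L≤a zero    = ℕ.≤-refl
    L≤a (suc i) = ℕ.<⇒≤ (proj₁ (c-left (opposite i)))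
    a<R : ∀ t → a < R t
    a<R zero    = a<Pa
    a<R (suc j) = proj₁ (proj₂ (c-left j))
    L<R : ∀ s t → reverse L s < reverse R t
    L<R s t = ℕ.≤-<-trans (L≤a (opposite s)) (a<R (opposite t))
    outside-in : ∀ u → P (L u) ≡ R (reflect-tail u)
    outside-in zero    = refl
    outside-in (suc t) = refl
    L-partner : ∀ s → P (reverse L s) ≡ reverse R (reflect-init s)
    L-partner s = trans (outside-in (opposite s))
      (cong R (sym (opposite-involutive (reflect-tail (opposite s)))))

  rights-sorted : AllPairs _<_ rights
  rights-sorted = AllPairs.filter⁺ rightCrosser? crossers-sorted

  lefts-sorted : AllPairs _<_ lefts
  lefts-sorted = AllPairs.filter⁺ leftCrosser? crossers-sorted

  ∈-rights : ∀ {x} → x ∈ rights → RightCrosser x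
  ∈-rights = proj₂ ∘ ∈-filter⁻ rightCrosser? {xs = crossers}

  ∈-lefts : ∀ {x} → x ∈ lefts → LeftCrosser x
  ∈-lefts = proj₂ ∘ ∈-filter⁻ leftCrosser? {xs = crossers}

  from-rights : ∀ m → m * pred m ℕ.< length rights →
    Σ (Matching (suc m)) λ N → (IsBrokenNesting N ⊎ IsInterleaving N) × Contains M N
  from-rights m many with erdős–szekeres m m rights rights-sorted many
  ... | inj₁ (c , c-asc , c∈) = map₂ (map₁ inj₂) (interleaving-in c c-asc λ i j →
          ℕ.<-trans (proj₁ (proj₂ (∈-rights (c∈ i)))) (proj₂ (proj₂ (∈-rights (c∈ j)))))
  ... | inj₂ (c , c-desc , c∈) = map₂ (map₁ (inj₁ ∘ inj₁)) (left-broken-in c c-desc (∈-rights ∘ c∈))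

  from-lefts : ∀ m → m * pred m ℕ.< length lefts →
    Σ (Matching (suc m)) λ N → (IsBrokenNesting N ⊎ IsInterleaving N) × Contains M N
  from-lefts m many with erdős–szekeres m m lefts lefts-sorted many
  ... | inj₁ (c , c-asc , c∈) = map₂ (map₁ inj₂) (interleaving-in c c-asc λ i j →
          ℕ.<-trans (proj₁ (∈-lefts (c∈ i))) (proj₁ (proj₂ (∈-lefts (c∈ j)))))
  ... | inj₂ (c , c-desc , c∈) = map₂ (map₁ (inj₁ ∘ inj₂)) (right-broken-in c c-desc (∈-lefts ∘ c∈))

  from-crossers : ∀ m → 2 * m ^ 2 + 2 ℕ.≤ length rights + length lefts →
    Σ (Matching (suc m)) λ N → (IsBrokenNesting N ⊎ IsInterleaving N) × Contains M N
  from-crossers m many with larger-side m many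
  ... | inj₁ many-rights = from-rights m many-rights
  ... | inj₂ many-lefts  = from-lefts m many-lefts

lemma2p1 : (k : ℕ) → k ≥ 1 → (n : ℕ) → (M : Matching n) →
    (a : Fin (2 * n)) → a < partner M a →
    (Σ (Fin (2 * (k ∸ 1) ^ 2 + 2) → Fin (2 * n)) λ g →
       Injective _≡_ _≡_ g × (∀ j → CrossesEdge M a (g j))) →
    Σ (Matching k) λ N → (IsBrokenNesting N ⊎ IsInterleaving N) × Contains M N
lemma2p1 zero    ()
lemma2p1 (suc m) _ n M a a<Pa (g , g-injective , g-crosses) =
  from-crossers m (crossers-count g g-injective g-crosses)
  where open Crossings M a a<Pa
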